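{- Let $\mathcal{T}$ be a Task Arrival Process and run the scheduler $\mathsf{H}$ on it. Every task $\tau_i\in\mathcal{A}\cup\mathcal{F}$ is assigned to the fast machine by $\mathsf{OPT}(t_i)$.
   Context: A task is a triple $\tau_i=(f_i,s_i,t_i)$ with $s_i\ge f_i>0$, $t_i\ge0$: running time $f_i$ on the single fast machine, $s_i$ on any of infinitely many slow machines, arrival time $t_i$ (revealed to an online scheduler at $t_i$; cannot start earlier; each machine runs one task at a time). A Task Arrival Process (TAP) $\mathcal{T}$ is a finite set of tasks. Offline algorithm $\mathsf{OPT}$: applied to a finite set of tasks with optimal offline completion time $c$, it assigns each task $\tau_j$ with $s_j+t_j\le c$ to a slow machine and every other task to the fast machine (achieving completion time $c$). $\mathsf{OPT}(t)$ is $\mathsf{OPT}$ applied to the tasks of $\mathcal{T}$ with arrival time at most $t$, with completion time $\mathsf{C}^t$; $\mathsf{OPT}(\infty)$ is $\mathsf{OPT}$ applied to all of $\mathcal{T}$. Let $\varphi=\frac{1+\sqrt5}{2}$. Algorithm $\mathsf{H}$ (Eventually-committing: once started, a task stays on its machine): it keeps a standby set $\mathcal{S}$; each task joins $\mathcal{S}$ on arrival. At every time $t$, for each $\tau_i\in\mathcal{S}$: (1) if $s_i+t\le\varphi\mathsf{C}^t$, start $\tau_i$ on an unused slow machine and remove it from $\mathcal{S}$; (2) otherwise, if (a) the fast machine is free or just finished a task, (b) $\tau_i$ has the largest $s_i+t_i$ among all tasks in $\mathcal{S}$, and (c) $t\ge f_i/\varphi$, start $\tau_i$ on the fast machine and remove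 it from $\mathcal{S}$ (ties in (b) broken arbitrarily among tied tasks satisfying (c)). $\mathcal{A}$ is the set of tasks that both $\mathsf{H}$ and $\mathsf{OPT}(\infty)$ assign to the fast machine; $\mathcal{F}$ is the set of tasks that $\mathsf{H}$ assigns to the fast machine but $\mathsf{OPT}(\infty)$ assigns to a slow machine. -}

module Defs where

open import Data.Nat using (ℕ)
open import Data.Fin using (Fin)
open import Data.Bool using (Bool; true; false)
open import Data.Product using (Σ; _×_; ∃)
open import Data.Sum using (_⊎_)
open import Relation.Nullary using (¬_)
open import Data.Empty using (⊥)
open import Relation.Binary.PropositionalEquality using (_≡_; _≢_)
open import Algebra.Structures using (IsCommutativeRing)
open import Relation.Binary.Structures using (IsTotalOrder)

-- The time/length domain: an ordered field (the reals are the intended model).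
-- Equality is propositional equality.
record OrderedField : Set₁ where
  infixl 6 _+_
  infixl 7 _*_
  infix 4 _≤_ _<_
  field
    Carrier : Set
    0# 1#   : Carrier
    _+_ _*_ : Carrier → Carrier → Carrier
    -_      : Carrier → Carrier
    _≤_     : Carrier → Carrier → Set
    isCommutativeRing : IsCommutativeRing _≡_ _+_ _*_ -_ 0# 1#
    isTotalOrder      : IsTotalOrder _≡_ _≤_
    +-mono-≤  : ∀ {x y} z → x ≤ y → x + z ≤ y + z
    *-nonneg  : ∀ {x y} → 0# ≤ x → 0# ≤ y → 0# ≤ x * y
    0≢1       : 0# ≢ 1#
    inverse   : ∀ x → x ≢ 0# → Σ Carrier (λ y → x * y ≡ 1#)

  _<_ : Carrier → Carrier → Set
  x < y = x ≤ y × x ≢ y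

module Scheduling (F : OrderedField) where
  open OrderedField F

  -- A task τ = (f, s, t): fast time, slow time, arrival time.
  record Task : Set where
    constructor task
    field
      f s t : Carrier
  open Task public

  record TAP : Set where
    field
      n     : ℕ
      τ     : Fin n → Task
      f-pos : ∀ i → 0# < f (τ i)
      f≤s   : ∀ i → f (τ i) ≤ s (τ i)
      t-nonneg : ∀ i → 0# ≤ t (τ i)
  open TAP public

  module _ (T : TAP) where
    private
      N = n T
      fᵢ sᵢ tᵢ : Fin N → Carrier
      fᵢ i = f (τ T i)
      sᵢ i = s (τ T i)
      tᵢ i = t (τ T i)

    -- A (non-preemptive) offline schedule of the tasks j with P j:
    -- each task is put on the fast machine (true) or on its own slow machine
    -- (false), starts no earlier than its arrival, and fast tasks do not overlap.
    record Schedule (P : Fin N → Set) : Set where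
      field
        onFast : Fin N → Bool
        start  : Fin N → Carrier
        arrival : ∀ j → P j → tᵢ j ≤ start j
        noOverlap : ∀ i j → P i → P j → i ≢ j → onFast i ≡ true → onFast j ≡ true →
                    (start i + fᵢ i ≤ start j) ⊎ (start j + fᵢ j ≤ start i)

      finish : Fin N → Carrier
      finish j with onFast j
      ... | true  = start j + fᵢ j
      ... | false = start j + sᵢ j

    -- c is the optimal offline completion time of the tasks j with P j
    -- (completion times are taken ≥ 0, so the empty set has completion time 0).
    IsOptCompletion : (Fin N → Set) → Carrier → Set
    IsOptCompletion P c =
      (0# ≤ c × Σ (Schedule P) (λ σ → ∀ j → P j → Schedule.finish σ j ≤ c))
      × (∀ (σ : Schedule P) c' → 0# ≤ c' → (∀ j → P j → Schedule.finish σ j ≤ c') → c ≤ c')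

    -- Tasks arrived by time t (the input of OPT(t)).
    ArrivedBy : Carrier → Fin N → Set
    ArrivedBy u j = tᵢ j ≤ u

    -- OPT with optimal completion time c assigns τ_j to a slow machine iff
    -- s_j + t_j ≤ c, and to the fast machine otherwise.
    OPTFast : Carrier → Fin N → Set
    OPTFast c j = ¬ (sᵢ j + tᵢ j ≤ c)

    -- A run of algorithm H, given φ and the function t ↦ C^t.
    -- onFast j / start j: machine type and start time that H gives to τ_j.
    module _ (φ : Carrier) (C : Carrier → Carrier) where

      record HRun : Set where
        field
          onFast : Fin N → Bool
          start  : Fin N → Carrier

        -- τ_j is in the standby set at decision time u (arrived, not started before u)
        InS : Carrier → Fin N → Set
        InS u j = tᵢ j ≤ u × u ≤ start j

        SlowOK : Carrier → Fin N → Set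
        SlowOK u j = sᵢ j + u ≤ φ * C u

        -- tasks of S at time u not removed by rule (1): the competitors in rule (2b)
        Cand : Carrier → Fin N → Set
        Cand u j = InS u j × ¬ SlowOK u j

        FastFree : Carrier → Set
        FastFree u = ∀ k → onFast k ≡ true → ¬ (start k ≤ u × u < start k + fᵢ k)

        field
          arrival : ∀ j → tᵢ j ≤ start j
          rule1 : ∀ j u → InS u j → SlowOK u j → (onFast j ≡ false × start j ≡ u)
          slowStart : ∀ j → onFast j ≡ false → SlowOK (start j) j
          fastA : ∀ i k → i ≢ k → onFast i ≡ true → onFast k ≡ true →
                  (start k + fᵢ k ≤ start i) ⊎ (start i + fᵢ i ≤ start k)
          fastB : ∀ i k → onFast i ≡ true → Cand (start i) k → sᵢ k + tᵢ k ≤ sᵢ i + tᵢ i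
          fastC : ∀ i → onFast i ≡ true → fᵢ i ≤ φ * start i
          -- rule (2) is applied whenever it applies: it is never the case that the
          -- fast machine is free at u while a waiting task meets (b) and (c)
          fastGreedy : ∀ u i → FastFree u → Cand u i →
                       (∀ k → Cand u k → sᵢ k + tᵢ k ≤ sᵢ i + tᵢ i) →
                       fᵢ i ≤ φ * u → ⊥

      -- 𝒜: fast under both H and OPT(∞);  ℱ: fast under H, slow under OPT(∞).
      -- c∞ is the optimal completion time of all tasks.
      InA : HRun → Carrier → Fin N → Set
      InA H c∞ i = HRun.onFast H i ≡ true × OPTFast c∞ i

      InF : HRun → Carrier → Fin N → Set
      InF H c∞ i = HRun.onFast H i ≡ true × ¬ OPTFast c∞ i

{-# OPTIONS --safe #-}
-- If OPT(t_i) put τ_i on a slow machine, then s_i + t_i ≤ C^{t_i} ≤ φ C^{t_i},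
-- because φ ≥ 1 for the positive root of φ² = φ + 1 and completion times are
-- nonnegative. So rule (1) of H already fires at the arrival time t_i and H starts
-- τ_i on a slow machine, contradicting τ_i ∈ 𝒜 ∪ ℱ. Neither OPT(∞) nor rule (2)
-- plays any role.
module Submission where

open import Defs
open import Data.Fin using (Fin)
open import Data.Unit using (⊤)
open import Data.Sum using (_⊎_; inj₁; inj₂)
open import Data.Product using (_,_; proj₁)
open import Data.Bool using (true)
open import Relation.Nullary using (¬_; contradiction)
open import Relation.Binary.PropositionalEquality
  using (_≡_; refl; sym; trans; cong; cong₂; subst₂; module ≡-Reasoning)
open import Relation.Binary.Structures using (IsTotalOrder)
open import Algebra.Bundles using (CommutativeRing)
import Algebra.Properties.Ring as RingProperties
import Algebra.Properties.Group as GroupProperties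
import Algebra.Properties.AbelianGroup as AbelianGroupProperties

module OrderedFieldProperties (F : OrderedField) where
  open OrderedField F

  commutativeRing : CommutativeRing _ _
  commutativeRing = record { isCommutativeRing = isCommutativeRing }

  open CommutativeRing commutativeRing
    using (_-_; +-identityˡ; +-identityʳ; -‿inverseˡ; -‿inverseʳ; +-assoc;
           *-identityˡ; *-identityʳ; ring; +-group; +-abelianGroup)
  open RingProperties ring using (-‿distribˡ-*; -‿distribʳ-*; x[y-z]≈xy-xz; [y-z]x≈yx-zx)
  open GroupProperties +-group using (⁻¹-involutive)
  open AbelianGroupProperties +-abelianGroup using (⁻¹-∙-comm)
  open IsTotalOrder isTotalOrder using (total; antisym)

  x≤y⇒0≤y-x : ∀ {x y} → x ≤ y → 0# ≤ y - x
  x≤y⇒0≤y-x {x} p = subst₂ _≤_ (-‿inverseʳ x) refl (+-mono-≤ (- x) p)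

  0≤y-x⇒x≤y : ∀ {x y} → 0# ≤ y - x → x ≤ y
  0≤y-x⇒x≤y {x} {y} p = subst₂ _≤_ (+-identityˡ x) y-x+x≡y (+-mono-≤ x p)
    where
    y-x+x≡y : y - x + x ≡ y
    y-x+x≡y = trans (+-assoc y (- x) x) (trans (cong (y +_) (-‿inverseˡ x)) (+-identityʳ y))

  -x*-x≡x*x : ∀ x → - x * - x ≡ x * x
  -x*-x≡x*x x = begin
    - x * - x     ≡⟨ -‿distribˡ-* x (- x) ⟨
    - (x * - x)   ≡⟨ cong -_ (-‿distribʳ-* x x) ⟨
    - - (x * x)   ≡⟨ ⁻¹-involutive (x * x) ⟩
    x * x         ∎
    where open ≡-Reasoning

  0≤x*x : ∀ x → 0# ≤ x * x
  0≤x*x x with total 0# x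
  ... | inj₁ 0≤x = *-nonneg 0≤x 0≤x
  ... | inj₂ x≤0 = subst₂ _≤_ refl (-x*-x≡x*x x) (*-nonneg 0≤-x 0≤-x)
    where
    0≤-x : 0# ≤ - x
    0≤-x = subst₂ _≤_ refl (+-identityˡ (- x)) (x≤y⇒0≤y-x x≤0)

  1≰0 : ¬ 1# ≤ 0#
  1≰0 1≤0 = 0≢1 (antisym 0≤1 1≤0)
    where
    0≤1 : 0# ≤ 1#
    0≤1 = subst₂ _≤_ refl (*-identityˡ 1#) (0≤x*x 1#)

  x*x≡x+1⇒1≤x : ∀ {x} → x * x ≡ x + 1# → 0# ≤ x → 1# ≤ x
  x*x≡x+1⇒1≤x {x} golden 0≤x with total x 1#
  ... | inj₂ 1≤x = 1≤x
  ... | inj₁ x≤1 =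
    contradiction (0≤y-x⇒x≤y (subst₂ _≤_ refl x[1-x]≡0-1 (*-nonneg 0≤x (x≤y⇒0≤y-x x≤1)))) 1≰0
    where
    x[1-x]≡0-1 : x * (1# - x) ≡ 0# - 1#
    x[1-x]≡0-1 = begin
      x * (1# - x)       ≡⟨ x[y-z]≈xy-xz x 1# x ⟩
      x * 1# - x * x     ≡⟨ cong₂ _-_ (*-identityʳ x) golden ⟩
      x - (x + 1#)       ≡⟨ cong (x +_) (⁻¹-∙-comm x 1#) ⟨
      x + (- x + - 1#)   ≡⟨ +-assoc x (- x) (- 1#) ⟨
      (x - x) - 1#       ≡⟨ cong (_- 1#) (-‿inverseʳ x) ⟩
      0# - 1#            ∎
      where open ≡-Reasoning

  1≤y⇒x≤y*x : ∀ {y x} → 1# ≤ y → 0# ≤ x → x ≤ y * x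
  1≤y⇒x≤y*x {y} {x} 1≤y 0≤x =
    0≤y-x⇒x≤y (subst₂ _≤_ refl [y-1]x≡yx-x (*-nonneg (x≤y⇒0≤y-x 1≤y) 0≤x))
    where
    [y-1]x≡yx-x : (y - 1#) * x ≡ y * x - x
    [y-1]x≡yx-x = trans ([y-z]x≈yx-zx x y 1#) (cong (λ z → y * x - z) (*-identityˡ x))

module HRunProperties (F : OrderedField) (T : Scheduling.TAP F) {φ : OrderedField.Carrier F}
                      {C : OrderedField.Carrier F → OrderedField.Carrier F}
                      (H : Scheduling.HRun F T φ C) where
  open OrderedField F
  open Scheduling F
  open HRun H
  open IsTotalOrder isTotalOrder using () renaming (refl to ≤-refl)

  InS-arrival : ∀ j → InS (t (τ T j)) j
  InS-arrival j = ≤-refl , arrival j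

  onFast⇒¬SlowOK : ∀ {u j} → onFast j ≡ true → InS u j → ¬ SlowOK u j
  onFast⇒¬SlowOK {u} {j} fast waiting slowOK with trans (sym fast) (proj₁ (rule1 j u waiting slowOK))
  ... | ()

  A⊎F⇒onFast : ∀ {c∞ j} → InA T φ C H c∞ j ⊎ InF T φ C H c∞ j → onFast j ≡ true
  A⊎F⇒onFast (inj₁ (fast , _)) = fast
  A⊎F⇒onFast (inj₂ (fast , _)) = fast

lemma2 : (F : OrderedField) → let open OrderedField F in let open Scheduling F in
    (φ : Carrier) → φ * φ ≡ φ + 1# → 0# < φ →
    (T : TAP) →
    (C : Carrier → Carrier) → (∀ u → IsOptCompletion T (ArrivedBy T u) (C u)) →
    (c∞ : Carrier) → IsOptCompletion T (λ _ → ⊤) c∞ →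
    (H : HRun T φ C) →
    ∀ (i : Fin (n T)) → InA T φ C H c∞ i ⊎ InF T φ C H c∞ i →
    OPTFast T (C (t (τ T i))) i
lemma2 F φ golden (0≤φ , _) T C optC c∞ _ H i A⊎F slowInOPT =
  onFast⇒¬SlowOK (A⊎F⇒onFast A⊎F) (InS-arrival i) (≤-trans slowInOPT Cᵗ≤φCᵗ)
  where
  open OrderedField F
  open Scheduling F
  open OrderedFieldProperties F
  open HRunProperties F T H
  open IsTotalOrder isTotalOrder using () renaming (trans to ≤-trans)

  tᵢ : Carrier
  tᵢ = t (τ T i)

  0≤Cᵗ : 0# ≤ C tᵢ
  0≤Cᵗ = proj₁ (proj₁ (optC tᵢ))

  Cᵗ≤φCᵗ : C tᵢ ≤ φ * C tᵢ
  Cᵗ≤φCᵗ = 1≤y⇒x≤y*x (x*x≡x+1⇒1≤x golden 0≤φ) 0≤Cᵗ
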